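{- Let $G$ be a cubic planar graph and let $H$ be the corresponding auxiliary graph (defined in the context). If $G$ has a two-coloured perfect matching, then $H$ has a good coloured orientation.
   Context: A two-coloured perfect matching of $G$ is a colouring of its vertices with black and white in which every vertex has exactly one neighbour of the same colour. The auxiliary graph $H$ is obtained from $G$ by replacing every edge $uv$ of $G$ by the following gadget (an auxiliary edge): new vertices $x,y,z,w,\mathrm{in},\mathrm{out}$ with edges $ux,xy,xz,yw,zw,wv,y\,\mathrm{in},z\,\mathrm{out}$; the vertex $\mathrm{in}$ is the invertex and $\mathrm{out}$ the outvertex. A coloured orientation of $H$ is a colouring of its vertices with black and white together with an orientation of some of its edges such that: every vertex is adjacent to at most one vertex of the opposite colour; an edge is oriented if and only if it is monochromatic (both ends of the same colour); every vertex except the outvertices has outdegree at most two and indegree at most one (unoriented edges not counted); every outvertex has indegree zero. A coloured orientation is good if every vertex of degree three is adjacent to precisely one vertex of the opposite colour and has indegree one and outdegree one. -}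

module Defs where

open import Data.Nat using (ℕ; zero; suc; _+_)
open import Data.Fin using (Fin)
open import Data.Bool using (Bool; true; false; not)
open import Data.Product using (Σ; _×_; _,_; ∃; proj₁; proj₂)
open import Data.Sum using (_⊎_)
open import Relation.Binary.PropositionalEquality using (_≡_; _≢_)
open import Function.Definitions using (Injective)
open import Relation.Nullary using (¬_)

AtMostOne : {A : Set} → (A → Set) → Set
AtMostOne {A} P = (a b : A) → P a → P b → a ≡ b

ExactlyOne : {A : Set} → (A → Set) → Set
ExactlyOne {A} P = Σ A (λ a → P a) × AtMostOne P

AtMostTwo : {A : Set} → (A → Set) → Set
AtMostTwo {A} P = (a b c : A) → P a → P b → P c → (a ≡ b) ⊎ ((a ≡ c) ⊎ (b ≡ c))

ExactlyThree : {A : Set} → (A → Set) → Set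
ExactlyThree {A} P =
  Σ A λ a → Σ A λ b → Σ A λ c →
    (a ≢ b) × (a ≢ c) × (b ≢ c) × P a × P b × P c ×
    ((d : A) → P d → (d ≡ a) ⊎ ((d ≡ b) ⊎ (d ≡ c)))

iter : {A : Set} → ℕ → (A → A) → A → A
iter zero    f a = a
iter (suc k) f a = f (iter k f a)

record Graph : Set where
  field
    n   : ℕ
    m   : ℕ
    src : Fin m → Fin n
    tgt : Fin m → Fin n
open Graph public

Incident : (G : Graph) → Fin (m G) → Fin (n G) → Set
Incident G e v = (src G e ≡ v) ⊎ (tgt G e ≡ v)

Adj : (G : Graph) → Fin (n G) → Fin (n G) → Set
Adj G u v = Σ (Fin (m G)) λ e →
  ((src G e ≡ u) × (tgt G e ≡ v)) ⊎ ((src G e ≡ v) × (tgt G e ≡ u))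

Simple : Graph → Set
Simple G =
  ((e : Fin (m G)) → src G e ≢ tgt G e) ×
  ((e f : Fin (m G)) →
     ((src G e ≡ src G f) × (tgt G e ≡ tgt G f)) ⊎
     ((src G e ≡ tgt G f) × (tgt G e ≡ src G f)) → e ≡ f)

Cubic : Graph → Set
Cubic G = (v : Fin (n G)) → ExactlyThree (λ e → Incident G e v)

-- Planarity, combinatorially: a rotation system of genus 0
-- (Euler's formula  V - E + F = 2C  with F the faces of the
-- rotation system and C the number of connected components).

Dart : Graph → Set
Dart G = Fin (m G) × Bool

dartVertex : (G : Graph) → Dart G → Fin (n G)
dartVertex G (e , false) = src G e
dartVertex G (e , true)  = tgt G e

flip : (G : Graph) → Dart G → Dart G
flip G (e , b) = (e , not b)

data Connected (G : Graph) : Fin (n G) → Fin (n G) → Set where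
  here : ∀ {u} → Connected G u u
  step : ∀ {u v w} → Adj G u v → Connected G v w → Connected G u w

record PlanarEmbedding (G : Graph) : Set where
  field
    σ        : Dart G → Dart G
    σ-inj    : Injective _≡_ _≡_ σ
    σ-vertex : (d : Dart G) → dartVertex G (σ d) ≡ dartVertex G d
    σ-cyclic : (d d' : Dart G) → dartVertex G d ≡ dartVertex G d' →
               ∃ λ k → iter k σ d ≡ d'
    f        : ℕ
    face     : Dart G → Fin f
    face-sur : (i : Fin f) → ∃ λ d → face d ≡ i
    face-orb : (d d' : Dart G) →
               (face d ≡ face d' → ∃ λ k → iter k (λ x → σ (flip G x)) d ≡ d') ×
               ((∃ λ k → iter k (λ x → σ (flip G x)) d ≡ d') → face d ≡ face d')
    c        : ℕ
    comp     : Fin (n G) → Fin c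
    comp-sur : (i : Fin c) → ∃ λ v → comp v ≡ i
    comp-con : (u v : Fin (n G)) →
               (comp u ≡ comp v → Connected G u v) ×
               (Connected G u v → comp u ≡ comp v)
    euler    : n G + f ≡ m G + (c + c)

Planar : Graph → Set
Planar G = PlanarEmbedding G

TwoColouredPM : (G : Graph) → (Fin (n G) → Bool) → Set
TwoColouredPM G col = (v : Fin (n G)) →
  ExactlyOne (λ u → Adj G v u × (col u ≡ col v))

HasTwoColouredPM : Graph → Set
HasTwoColouredPM G = Σ (Fin (n G) → Bool) (TwoColouredPM G)

-- The auxiliary graph H.  Edge e with src u, tgt v is replaced by
-- gadget vertices x,y,z,w,in,out and edges
-- ux, xy, xz, yw, zw, wv, y in, z out.

data GVert : Set where
  gx gy gz gw gin gout : GVert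

data GEdge : Set where
  eux exy exz eyw ezw ewv eyin ezout : GEdge

HVert : Graph → Set
HVert G = Fin (n G) ⊎ (Fin (m G) × GVert)

HEdge : Graph → Set
HEdge G = Fin (m G) × GEdge

open import Data.Sum using (inj₁; inj₂)

hEnds : (G : Graph) → HEdge G → HVert G × HVert G
hEnds G (e , eux)   = inj₁ (src G e) , inj₂ (e , gx)
hEnds G (e , exy)   = inj₂ (e , gx)  , inj₂ (e , gy)
hEnds G (e , exz)   = inj₂ (e , gx)  , inj₂ (e , gz)
hEnds G (e , eyw)   = inj₂ (e , gy)  , inj₂ (e , gw)
hEnds G (e , ezw)   = inj₂ (e , gz)  , inj₂ (e , gw)
hEnds G (e , ewv)   = inj₂ (e , gw)  , inj₁ (tgt G e)
hEnds G (e , eyin)  = inj₂ (e , gy)  , inj₂ (e , gin)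
hEnds G (e , ezout) = inj₂ (e , gz)  , inj₂ (e , gout)

hEnd1 hEnd2 : (G : Graph) → HEdge G → HVert G
hEnd1 G h = proj₁ (hEnds G h)
hEnd2 G h = proj₂ (hEnds G h)

HIncident : (G : Graph) → HEdge G → HVert G → Set
HIncident G h a = (hEnd1 G h ≡ a) ⊎ (hEnd2 G h ≡ a)

HAdj : (G : Graph) → HVert G → HVert G → Set
HAdj G a b = Σ (HEdge G) λ h →
  ((hEnd1 G h ≡ a) × (hEnd2 G h ≡ b)) ⊎ ((hEnd1 G h ≡ b) × (hEnd2 G h ≡ a))

IsOutvertex : (G : Graph) → HVert G → Set
IsOutvertex G a = Σ (Fin (m G)) λ e → a ≡ inj₂ (e , gout)

-- each edge is unoriented, oriented end1→end2 (fwd) or end2→end1 (bwd)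
data Dir : Set where
  none fwd bwd : Dir

OutOf : (G : Graph) → (HEdge G → Dir) → HEdge G → HVert G → Set
OutOf G o h a = ((o h ≡ fwd) × (hEnd1 G h ≡ a)) ⊎ ((o h ≡ bwd) × (hEnd2 G h ≡ a))

Into : (G : Graph) → (HEdge G → Dir) → HEdge G → HVert G → Set
Into G o h a = ((o h ≡ fwd) × (hEnd2 G h ≡ a)) ⊎ ((o h ≡ bwd) × (hEnd1 G h ≡ a))

record ColouredOrientation (G : Graph) : Set where
  field
    colour : HVert G → Bool
    orient : HEdge G → Dir
    atMostOneOpp : (a : HVert G) →
      AtMostOne (λ b → HAdj G a b × (colour b ≢ colour a))
    orientedIffMono : (h : HEdge G) →
      (orient h ≢ none → colour (hEnd1 G h) ≡ colour (hEnd2 G h)) ×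
      (colour (hEnd1 G h) ≡ colour (hEnd2 G h) → orient h ≢ none)
    outDeg≤2 : (a : HVert G) → ¬ IsOutvertex G a →
      AtMostTwo (λ h → OutOf G orient h a)
    inDeg≤1  : (a : HVert G) → ¬ IsOutvertex G a →
      AtMostOne (λ h → Into G orient h a)
    outIn0   : (a : HVert G) → IsOutvertex G a →
      (h : HEdge G) → ¬ Into G orient h a
open ColouredOrientation public

HDegree3 : (G : Graph) → HVert G → Set
HDegree3 G a = ExactlyThree (λ h → HIncident G h a)

Good : (G : Graph) → ColouredOrientation G → Set
Good G co = (a : HVert G) → HDegree3 G a →
  ExactlyOne (λ b → HAdj G a b × (colour co b ≢ colour co a)) ×
  ExactlyOne (λ h → Into G (orient co) h a) ×
  ExactlyOne (λ h → OutOf G (orient co) h a)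

HasGoodColouredOrientation : Graph → Set
HasGoodColouredOrientation G = Σ (ColouredOrientation G) (Good G)

module Submission where

-- The monochromatic edges of col form a perfect matching M; the other edges
-- form a 2-factor, and we orient each of its cycles.  On the darts
-- (half-edges) of G there are two fixed-point-free involutions: flip (the other
-- dart of the same edge) and partner (the other non-matching dart at the same
-- vertex; flip for a matching dart).  The graph they generate consists of
-- alternating cycles and is bipartite (module AlternatingCycles: compare the
-- minima of the two orbits of flip ∘ partner), so there is  side : darts → Bool
-- reversed by both involutions; side d = true means that the edge of d leaves
-- the vertex of d.
-- Every edge of G then gets a role (in M, or oriented towards one of its ends)
-- and its gadget is coloured and oriented by a fixed table for that role.  The
-- requirements at the inner gadget vertices are finite facts about these tables,
-- checked by exhaustive decision procedures (the opaque block below); at the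
-- vertices of G they follow from the properties of side and of M.  Planarity
-- enters only through the rotation system, which at a cubic vertex cyclically
-- permutes its three darts.

open import Defs
open import Data.Nat using (ℕ; zero; suc; _+_; _∸_; _≤_; _⊓_; _<?_; z≤n; s≤s)
open import Data.Nat.Properties
  using (+-comm; +-suc; ≤-refl; ≤-trans; ≤-pred; ≤-antisym; ≤-total; <⇒≤; n≤1+n; n<1+n;
         m≤n⇒m≤1+n; m≤n⇒m<n∨m≡n; m∸n≤m; m∸n+n≡m; m+[n∸m]≡n; m<n⇒0<n∸m; <-cmp; <-asym;
         ⊓-sel; ⊓-glb; m⊓n≤m; m⊓n≤n)
open import Data.Fin using (Fin; zero; suc; toℕ; _↑ˡ_; _↑ʳ_; splitAt)
open import Data.Fin.Properties
  using (all?; any?; pigeonhole; toℕ-injective; toℕ<n;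
         ↑ˡ-injective; ↑ʳ-injective; splitAt-↑ˡ; splitAt-↑ʳ)
  renaming (_≟_ to _≟ᶠ_)
open import Data.Bool using (Bool; true; false; not; if_then_else_; T)
open import Data.Bool.Properties using (not-injective; not-involutive; ¬-not; not-¬)
open import Data.Empty using (⊥; ⊥-elim)
open import Data.Vec using (Vec; _∷_; []; lookup)
open import Data.Product using (Σ; _×_; _,_; ∃; proj₁; proj₂)
open import Data.Sum using (_⊎_; inj₁; inj₂)
open import Function using (_∘_)
open import Function.Definitions using (Injective)
open import Relation.Binary.Definitions using (DecidableEquality; tri<; tri≈; tri>)
open import Relation.Binary.PropositionalEquality
open import Relation.Nullary
  using (¬_; Dec; yes; no; does; map′; ¬?; _×-dec_; _⊎-dec_; _→-dec_; T?; from-yes; contradiction)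
open import Relation.Nullary.Decidable using (dec-true; dec-false)

-- A type listed exhaustively by Fin size.  Equality and quantifiers over
-- it are decidable, which lets facts about the finite gadget be proved by
-- evaluation.
record Enumeration (A : Set) : Set where
  field
    size       : ℕ
    enum       : Fin size → A
    index      : A → Fin size
    enum-index : ∀ a → enum (index a) ≡ a
open Enumeration

module _ {A : Set} {{E : Enumeration A}} where

  _≟_ : DecidableEquality A
  a ≟ b = map′ index-injective (cong (index E)) (index E a ≟ᶠ index E b)
    where
    index-injective : index E a ≡ index E b → a ≡ b
    index-injective p = trans (sym (enum-index E a)) (trans (cong (enum E) p) (enum-index E b))

  ∀? : {P : A → Set} → (∀ a → Dec (P a)) → Dec (∀ a → P a)
  ∀? {P} P? = map′ (λ h a → subst P (enum-index E a) (h (index E a))) (λ h i → h (enum E i))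
                   (all? (λ i → P? (enum E i)))

  ∃? : {P : A → Set} → (∀ a → Dec (P a)) → Dec (Σ A P)
  ∃? {P} P? = map′ (λ (i , p) → enum E i , p) (λ (a , p) → index E a , subst P (sym (enum-index E a)) p)
                   (any? (λ i → P? (enum E i)))

  atMostOne? : {P : A → Set} → (∀ a → Dec (P a)) → Dec (AtMostOne P)
  atMostOne? P? = ∀? λ a → ∀? λ b → P? a →-dec (P? b →-dec (a ≟ b))

does-true : {P : Set} (p? : Dec P) → does p? ≡ true → P
does-true (yes p) _ = p

does-false : {P : Set} (p? : Dec P) → does p? ≡ false → ¬ P
does-false (no ¬p) _ = ¬p

true≢false : true ≢ false
true≢false ()

bool-cases : ∀ b → (b ≡ true) ⊎ (b ≡ false)
bool-cases true  = inj₁ refl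
bool-cases false = inj₂ refl

if-true : {A : Set} {b : Bool} {x y : A} → b ≡ true → (if b then x else y) ≡ x
if-true refl = refl

if-false : {A : Set} {b : Bool} {x y : A} → b ≡ false → (if b then x else y) ≡ y
if-false refl = refl

<?-flip : ∀ a b → a ≢ b → does (b <? a) ≡ not (does (a <? b))
<?-flip a b a≢b with <-cmp a b
... | tri< a<b _ _ rewrite dec-true (a <? b) a<b | dec-false (b <? a) (<-asym a<b) = refl
... | tri≈ _ a≡b _ = contradiction a≡b a≢b
... | tri> _ _ b<a rewrite dec-false (a <? b) (<-asym b<a) | dec-true (b <? a) b<a = refl

iter-+ : {A : Set} (j k : ℕ) (f : A → A) (x : A) → iter (j + k) f x ≡ iter j f (iter k f x)
iter-+ zero    k f x = refl
iter-+ (suc j) k f x = cong f (iter-+ j k f x)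

iter-suc : {A : Set} (k : ℕ) (f : A → A) (x : A) → iter (suc k) f x ≡ iter k f (f x)
iter-suc k f x = trans (cong (λ i → iter i f x) (+-comm 1 k)) (iter-+ k 1 f x)

iter-injective : {A : Set} {f : A → A} → Injective _≡_ _≡_ f → ∀ k → Injective _≡_ _≡_ (iter k f)
iter-injective f-inj zero    eq = eq
iter-injective f-inj (suc k) eq = iter-injective f-inj k (f-inj eq)

parity : ∀ k → Σ ℕ λ j → (k ≡ j + j) ⊎ (k ≡ suc (j + j))
parity zero = 0 , inj₁ refl
parity (suc k) with parity k
... | j , inj₁ refl = j , inj₂ refl
... | j , inj₂ refl = suc j , inj₁ (cong suc (sym (+-suc j j)))

minTo : (ℕ → ℕ) → ℕ → ℕ
minTo s zero    = s zero
minTo s (suc K) = minTo s K ⊓ s (suc K)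

minTo-≤ : ∀ s {K k} → k ≤ K → minTo s K ≤ s k
minTo-≤ s {zero}  z≤n = ≤-refl
minTo-≤ s {suc K} k≤K with m≤n⇒m<n∨m≡n k≤K
... | inj₁ k<K  = ≤-trans (m⊓n≤m (minTo s K) _) (minTo-≤ s (≤-pred k<K))
... | inj₂ refl = m⊓n≤n (minTo s K) _

minTo-greatest : ∀ s K {b} → (∀ k → k ≤ K → b ≤ s k) → b ≤ minTo s K
minTo-greatest s zero    below = below 0 z≤n
minTo-greatest s (suc K) below =
  ⊓-glb (minTo-greatest s K (λ k k≤K → below k (m≤n⇒m≤1+n k≤K))) (below (suc K) ≤-refl)

minTo-attained : ∀ s K → Σ ℕ λ k → (k ≤ K) × (minTo s K ≡ s k)
minTo-attained s zero = 0 , z≤n , refl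
minTo-attained s (suc K) with ⊓-sel (minTo s K) (s (suc K))
... | inj₂ eq = suc K , ≤-refl , eq
... | inj₁ eq with minTo-attained s K
...   | k , k≤K , eq' = k , m≤n⇒m≤1+n k≤K , trans eq eq'

minTo-shift : ∀ s s' K p → 1 ≤ p → p ≤ suc K → (∀ k → s (k + p) ≡ s k) →
              (∀ k → s' k ≡ s (suc k)) → minTo s' K ≡ minTo s K
minTo-shift s s' K (suc p) (s≤s z≤n) p≤ periodic shifted =
  ≤-antisym (minTo-greatest s K below) (minTo-greatest s' K above)
  where
  below : ∀ k → k ≤ K → minTo s' K ≤ s k
  below zero    _   = subst (minTo s' K ≤_) (trans (shifted p) (periodic 0)) (minTo-≤ s' (≤-pred p≤))
  below (suc k) k≤K = subst (minTo s' K ≤_) (shifted k) (minTo-≤ s' (≤-trans (n≤1+n k) k≤K))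
  wrap : s (suc K) ≡ s (K ∸ p)
  wrap = trans (cong s (sym (trans (+-suc (K ∸ p) p) (cong suc (m∸n+n≡m (≤-pred p≤))))))
               (periodic (K ∸ p))
  above : ∀ k → k ≤ K → minTo s K ≤ s' k
  above k k≤K with m≤n⇒m<n∨m≡n k≤K
  ... | inj₁ k<K  = subst (minTo s K ≤_) (sym (shifted k)) (minTo-≤ s k<K)
  ... | inj₂ refl = subst (minTo s K ≤_) (sym (trans (shifted K) wrap)) (minTo-≤ s (m∸n≤m K p))

-- Two fixed-point-free involutions r and t of a finite set A generate a graph
-- whose cycles alternate between r- and t-edges; it is bipartite.  The side of
-- x records which of the two orbits of  advance = r ∘ t  through the cycle of x
-- (that of x or that of r x) contains the element with the smallest code.
module AlternatingCycles {A : Set} {N : ℕ} (code : A → Fin N) (code-inj : Injective _≡_ _≡_ code)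
  (r t : A → A) (r-invol : ∀ x → r (r x) ≡ x) (t-invol : ∀ x → t (t x) ≡ x)
  (r-free : ∀ x → r x ≢ x) (t-free : ∀ x → t x ≢ x) where

  advance : A → A
  advance x = r (t x)

  walk : ℕ → A → A
  walk k = iter k advance

  r-injective : Injective _≡_ _≡_ r
  r-injective {x} {y} eq = trans (sym (r-invol x)) (trans (cong r eq) (r-invol y))

  t-injective : Injective _≡_ _≡_ t
  t-injective {x} {y} eq = trans (sym (t-invol x)) (trans (cong t eq) (t-invol y))

  walk-injective : ∀ k → Injective _≡_ _≡_ (walk k)
  walk-injective = iter-injective (t-injective ∘ r-injective)

  -- by the pigeonhole principle every walk returns within N steps
  periodic : ∀ x → Σ ℕ λ p → (1 ≤ p) × (p ≤ N) × (walk p x ≡ x)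
  periodic x with pigeonhole (n<1+n N) (λ i → code (walk (toℕ i) x))
  ... | i , j , i<j , same = toℕ j ∸ toℕ i , m<n⇒0<n∸m i<j ,
        ≤-trans (m∸n≤m (toℕ j) (toℕ i)) (≤-pred (toℕ<n j)) , sym returns
    where
    returns : x ≡ walk (toℕ j ∸ toℕ i) x
    returns = walk-injective (toℕ i) (trans (code-inj same)
      (trans (cong (λ k → walk k x) (sym (m+[n∸m]≡n (<⇒≤ i<j)))) (iter-+ (toℕ i) _ advance x)))

  orbitCode : A → ℕ → ℕ
  orbitCode x k = toℕ (code (walk k x))

  orbitMin : A → ℕ
  orbitMin x = minTo (orbitCode x) N

  orbitMin-advance : ∀ x → orbitMin (advance x) ≡ orbitMin x
  orbitMin-advance x with periodic x
  ... | p , 1≤p , p≤N , returns =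
    minTo-shift (orbitCode x) (orbitCode (advance x)) N p 1≤p (m≤n⇒m≤1+n p≤N)
      (λ k → cong (toℕ ∘ code) (trans (iter-+ k p advance x) (cong (walk k) returns)))
      (λ k → cong (toℕ ∘ code) (sym (iter-suc k advance x)))

  orbitMin-attained : ∀ x → Σ ℕ λ k → orbitMin x ≡ orbitCode x k
  orbitMin-attained x with minTo-attained (orbitCode x) N
  ... | k , _ , eq = k , eq

  walk-reverses : ∀ j y → walk j (r (walk j y)) ≡ r y
  walk-reverses zero    y = refl
  walk-reverses (suc j) y = begin
    walk (suc j) (r (advance (walk j y)))      ≡⟨ iter-suc j advance _ ⟩
    walk j (advance (r (advance (walk j y))))  ≡⟨ cong (walk j ∘ r) advance-reverses ⟩
    walk j (r (walk j y))                      ≡⟨ walk-reverses j y ⟩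
    r y                                        ∎
    where
    open ≡-Reasoning
    advance-reverses : t (r (r (t (walk j y)))) ≡ walk j y
    advance-reverses = trans (cong t (r-invol (t (walk j y)))) (t-invol (walk j y))

  -- The walk from x never reaches r x: after an even number 2j of steps this
  -- would make  walk j x  a fixed point of r, after 2j+1 steps a fixed point of t.
  never-reversed : ∀ k x → walk k x ≢ r x
  never-reversed k x eq with parity k
  ... | j , inj₁ refl = r-free y (sym (walk-injective j (begin
          walk j y          ≡⟨ sym (iter-+ j j advance x) ⟩
          walk (j + j) x    ≡⟨ eq ⟩
          r x               ≡⟨ sym (walk-reverses j x) ⟩
          walk j (r y)      ∎)))
    where
    open ≡-Reasoning
    y = walk j x
  ... | j , inj₂ refl = t-free y (r-injective (walk-injective j (begin
          walk j (advance y)    ≡⟨ sym (iter-+ j (suc j) advance x) ⟩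
          walk (j + suc j) x    ≡⟨ cong (λ i → walk i x) (+-suc j j) ⟩
          walk (suc (j + j)) x  ≡⟨ eq ⟩
          r x                   ≡⟨ sym (walk-reverses j x) ⟩
          walk j (r y)          ∎)))
    where
    open ≡-Reasoning
    y = walk j x

  orbits-apart : ∀ k l x → walk k x ≢ walk l (r x)
  orbits-apart k l x eq with ≤-total l k
  ... | inj₁ l≤k = never-reversed (k ∸ l) x (walk-injective l (begin
          walk l (walk (k ∸ l) x)   ≡⟨ sym (iter-+ l (k ∸ l) advance x) ⟩
          walk (l + (k ∸ l)) x      ≡⟨ cong (λ i → walk i x) (m+[n∸m]≡n l≤k) ⟩
          walk k x                  ≡⟨ eq ⟩
          walk l (r x)              ∎))
    where open ≡-Reasoning
  ... | inj₂ k≤l = never-reversed (l ∸ k) (r x) (begin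
          walk (l ∸ k) (r x)        ≡⟨ sym (walk-injective k back) ⟩
          x                         ≡⟨ sym (r-invol x) ⟩
          r (r x)                   ∎)
    where
    open ≡-Reasoning
    back : walk k x ≡ walk k (walk (l ∸ k) (r x))
    back = begin
      walk k x                      ≡⟨ eq ⟩
      walk l (r x)                  ≡⟨ cong (λ i → walk i (r x)) (sym (m+[n∸m]≡n k≤l)) ⟩
      walk (k + (l ∸ k)) (r x)      ≡⟨ iter-+ k (l ∸ k) advance (r x) ⟩
      walk k (walk (l ∸ k) (r x))   ∎

  orbitMin-apart : ∀ x → orbitMin x ≢ orbitMin (r x)
  orbitMin-apart x eq with orbitMin-attained x | orbitMin-attained (r x)
  ... | k , ek | l , el = orbits-apart k l x (code-inj (toℕ-injective (trans (sym ek) (trans eq el))))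

  side : A → Bool
  side x = does (orbitMin x <? orbitMin (r x))

  side-r : ∀ x → side (r x) ≡ not (side x)
  side-r x = trans (cong (λ y → does (orbitMin (r x) <? orbitMin y)) (r-invol x))
                   (<?-flip (orbitMin x) (orbitMin (r x)) (orbitMin-apart x))

  -- t x lies on the orbit of r x, and r (t x) on the orbit of x
  side-t : ∀ x → side (t x) ≡ not (side x)
  side-t x = trans (cong₂ (λ a b → does (a <? b)) min-t min-rt) (side-r x)
    where
    min-t : orbitMin (t x) ≡ orbitMin (r x)
    min-t = trans (sym (orbitMin-advance (t x))) (cong (orbitMin ∘ r) (t-invol x))
    min-rt : orbitMin (r (t x)) ≡ orbitMin (r (r x))
    min-rt = trans (orbitMin-advance x) (cong orbitMin (sym (r-invol x)))

OneOf3 : {A : Set} → A → A → A → A → Set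
OneOf3 x a b c = (x ≡ a) ⊎ (x ≡ b) ⊎ (x ≡ c)

distinct-in-pair : {A : Set} {a b c p q : A} → a ≢ b → a ≢ c → b ≢ c →
  (a ≡ p) ⊎ (a ≡ q) → (b ≡ p) ⊎ (b ≡ q) → (c ≡ p) ⊎ (c ≡ q) → ⊥
distinct-in-pair a≢b a≢c b≢c (inj₁ refl) (inj₁ refl) _           = a≢b refl
distinct-in-pair a≢b a≢c b≢c (inj₂ refl) (inj₂ refl) _           = a≢b refl
distinct-in-pair a≢b a≢c b≢c (inj₁ refl) (inj₂ _)    (inj₁ refl) = a≢c refl
distinct-in-pair a≢b a≢c b≢c (inj₂ refl) (inj₁ _)    (inj₂ refl) = a≢c refl
distinct-in-pair a≢b a≢c b≢c (inj₁ _)    (inj₂ refl) (inj₂ refl) = b≢c refl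
distinct-in-pair a≢b a≢c b≢c (inj₂ _)    (inj₁ refl) (inj₁ refl) = b≢c refl

first-covered : {A : Set} {a b c p q r : A} → a ≢ b → a ≢ c → b ≢ c →
  OneOf3 a p q r → OneOf3 b p q r → OneOf3 c p q r → OneOf3 p a b c
first-covered _   _   _   (inj₁ refl) _           _           = inj₁ refl
first-covered _   _   _   (inj₂ _)    (inj₁ refl) _           = inj₂ (inj₁ refl)
first-covered _   _   _   (inj₂ _)    (inj₂ _)    (inj₁ refl) = inj₂ (inj₂ refl)
first-covered a≢b a≢c b≢c (inj₂ ia)   (inj₂ ib)   (inj₂ ic)   =
  ⊥-elim (distinct-in-pair a≢b a≢c b≢c ia ib ic)

swap12 : {A : Set} {x p q r : A} → OneOf3 x p q r → OneOf3 x q p r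
swap12 (inj₁ e)        = inj₂ (inj₁ e)
swap12 (inj₂ (inj₁ e)) = inj₁ e
swap12 (inj₂ (inj₂ e)) = inj₂ (inj₂ e)

swap13 : {A : Set} {x p q r : A} → OneOf3 x p q r → OneOf3 x r q p
swap13 (inj₁ e)        = inj₂ (inj₂ e)
swap13 (inj₂ (inj₁ e)) = inj₂ (inj₁ e)
swap13 (inj₂ (inj₂ e)) = inj₁ e

distinct-in-triple : {A : Set} {a b c p q r : A} → a ≢ b → a ≢ c → b ≢ c →
  OneOf3 a p q r → OneOf3 b p q r → OneOf3 c p q r → ∀ x → OneOf3 x p q r → OneOf3 x a b c
distinct-in-triple a≢b a≢c b≢c ia ib ic x (inj₁ refl) = first-covered a≢b a≢c b≢c ia ib ic
distinct-in-triple a≢b a≢c b≢c ia ib ic x (inj₂ (inj₁ refl)) =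
  first-covered a≢b a≢c b≢c (swap12 ia) (swap12 ib) (swap12 ic)
distinct-in-triple a≢b a≢c b≢c ia ib ic x (inj₂ (inj₂ refl)) =
  first-covered a≢b a≢c b≢c (swap13 ia) (swap13 ib) (swap13 ic)

-- The role of an edge uv of G, which determines the table for its gadget:
-- in the matching, or not in the matching and oriented towards its end b
-- (b = false: towards u = src, b = true: towards v = tgt).
data Role : Set where
  matching : Role
  enters   : Bool → Role

-- The vertices of a single gadget: its ends u = end false, v = end true, and
-- its six inner vertices.
data LocalVertex : Set where
  end   : Bool → LocalVertex
  inner : GVert → LocalVertex

instance
  enumBool : Enumeration Bool
  enumBool = record { size = 2 ; enum = lookup elements ; index = position ; enum-index = listed }
    where
    elements : Vec Bool 2
    elements = false ∷ true ∷ []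
    position : Bool → Fin 2
    position false = zero
    position true  = suc zero
    listed : ∀ b → lookup elements (position b) ≡ b
    listed false = refl
    listed true  = refl

  enumRole : Enumeration Role
  enumRole = record { size = 3 ; enum = lookup elements ; index = position ; enum-index = listed }
    where
    elements : Vec Role 3
    elements = matching ∷ enters false ∷ enters true ∷ []
    position : Role → Fin 3
    position matching       = zero
    position (enters false) = suc zero
    position (enters true)  = suc (suc zero)
    listed : ∀ r → lookup elements (position r) ≡ r
    listed matching       = refl
    listed (enters false) = refl
    listed (enters true)  = refl

  enumDir : Enumeration Dir
  enumDir = record { size = 3 ; enum = lookup elements ; index = position ; enum-index = listed }
    where
    elements : Vec Dir 3
    elements = none ∷ fwd ∷ bwd ∷ []
    position : Dir → Fin 3
    position none = zero
    position fwd  = suc zero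
    position bwd  = suc (suc zero)
    listed : ∀ δ → lookup elements (position δ) ≡ δ
    listed none = refl
    listed fwd  = refl
    listed bwd  = refl

  enumGVert : Enumeration GVert
  enumGVert = record { size = 6 ; enum = lookup elements ; index = position ; enum-index = listed }
    where
    elements : Vec GVert 6
    elements = gx ∷ gy ∷ gz ∷ gw ∷ gin ∷ gout ∷ []
    position : GVert → Fin 6
    position gx   = zero
    position gy   = suc zero
    position gz   = suc (suc zero)
    position gw   = suc (suc (suc zero))
    position gin  = suc (suc (suc (suc zero)))
    position gout = suc (suc (suc (suc (suc zero))))
    listed : ∀ g → lookup elements (position g) ≡ g
    listed gx   = refl
    listed gy   = refl
    listed gz   = refl
    listed gw   = refl
    listed gin  = refl
    listed gout = refl

  enumGEdge : Enumeration GEdge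
  enumGEdge = record { size = 8 ; enum = lookup elements ; index = position ; enum-index = listed }
    where
    elements : Vec GEdge 8
    elements = eux ∷ exy ∷ exz ∷ eyw ∷ ezw ∷ ewv ∷ eyin ∷ ezout ∷ []
    position : GEdge → Fin 8
    position eux   = zero
    position exy   = suc zero
    position exz   = suc (suc zero)
    position eyw   = suc (suc (suc zero))
    position ezw   = suc (suc (suc (suc zero)))
    position ewv   = suc (suc (suc (suc (suc zero))))
    position eyin  = suc (suc (suc (suc (suc (suc zero)))))
    position ezout = suc (suc (suc (suc (suc (suc (suc zero))))))
    listed : ∀ g → lookup elements (position g) ≡ g
    listed eux   = refl
    listed exy   = refl
    listed exz   = refl
    listed eyw   = refl
    listed ezw   = refl
    listed ewv   = refl
    listed eyin  = refl
    listed ezout = refl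

  enumLocalVertex : Enumeration LocalVertex
  enumLocalVertex = record { size = 8 ; enum = lookup elements ; index = position ; enum-index = listed }
    where
    elements : Vec LocalVertex 8
    elements = end false ∷ end true ∷
               inner gx ∷ inner gy ∷ inner gz ∷ inner gw ∷ inner gin ∷ inner gout ∷ []
    position : LocalVertex → Fin 8
    position (end false)  = zero
    position (end true)   = suc zero
    position (inner gx)   = suc (suc zero)
    position (inner gy)   = suc (suc (suc zero))
    position (inner gz)   = suc (suc (suc (suc zero)))
    position (inner gw)   = suc (suc (suc (suc (suc zero))))
    position (inner gin)  = suc (suc (suc (suc (suc (suc zero)))))
    position (inner gout) = suc (suc (suc (suc (suc (suc (suc zero))))))
    listed : ∀ l → lookup elements (position l) ≡ l
    listed (end false)  = refl
    listed (end true)   = refl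
    listed (inner gx)   = refl
    listed (inner gy)   = refl
    listed (inner gz)   = refl
    listed (inner gw)   = refl
    listed (inner gin)  = refl
    listed (inner gout) = refl

tailEnd headEnd : GEdge → LocalVertex
tailEnd eux   = end false
tailEnd exy   = inner gx
tailEnd exz   = inner gx
tailEnd eyw   = inner gy
tailEnd ezw   = inner gz
tailEnd ewv   = inner gw
tailEnd eyin  = inner gy
tailEnd ezout = inner gz
headEnd eux   = inner gx
headEnd exy   = inner gy
headEnd exz   = inner gz
headEnd eyw   = inner gw
headEnd ezw   = inner gw
headEnd ewv   = end true
headEnd eyin  = inner gin
headEnd ezout = inner gout

-- A matching gadget
-- is the cycle x y w z of colour (not c) with in and out of colour c; in the
-- oriented gadgets one 2-path of the gadget carries the orientation from u to v
-- or from v to u.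
gadgetColour : Role → Bool → GVert → Bool
gadgetColour matching       c gin  = c
gadgetColour matching       c gout = c
gadgetColour matching       c _    = not c
gadgetColour (enters true)  c gz   = not c
gadgetColour (enters true)  c gw   = not c
gadgetColour (enters true)  c gout = not c
gadgetColour (enters true)  c _    = c
gadgetColour (enters false) c gy   = not c
gadgetColour (enters false) c gw   = not c
gadgetColour (enters false) c gin  = not c
gadgetColour (enters false) c _    = c

endColour : Role → Bool → Bool → Bool
endColour _          c false = c
endColour matching   c true  = c
endColour (enters _) c true  = not c

localColour : Role → Bool → LocalVertex → Bool
localColour r c (end b)   = endColour r c b
localColour r c (inner g) = gadgetColour r c g

gadgetOrient : Role → GEdge → Dir
gadgetOrient matching       exy   = fwd
gadgetOrient matching       exz   = bwd
gadgetOrient matching       eyw   = fwd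
gadgetOrient matching       ezw   = bwd
gadgetOrient matching       _     = none
gadgetOrient (enters true)  exz   = none
gadgetOrient (enters true)  eyw   = none
gadgetOrient (enters true)  ezout = bwd
gadgetOrient (enters true)  _     = fwd
gadgetOrient (enters false) exy   = none
gadgetOrient (enters false) ezw   = none
gadgetOrient (enters false) eyin  = fwd
gadgetOrient (enters false) _     = bwd

Head Tail : Dir → GEdge → LocalVertex → Set
Head δ g l = ((δ ≡ fwd) × (headEnd g ≡ l)) ⊎ ((δ ≡ bwd) × (tailEnd g ≡ l))
Tail δ g l = ((δ ≡ fwd) × (tailEnd g ≡ l)) ⊎ ((δ ≡ bwd) × (headEnd g ≡ l))

Joins : GEdge → LocalVertex → LocalVertex → Set
Joins g l l' = ((tailEnd g ≡ l) × (headEnd g ≡ l')) ⊎ ((tailEnd g ≡ l') × (headEnd g ≡ l))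

Touches : GEdge → LocalVertex → Set
Touches g l = (tailEnd g ≡ l) ⊎ (headEnd g ≡ l)

OppositeNbr : Role → Bool → LocalVertex → LocalVertex → Set
OppositeNbr r c l l' = Σ GEdge (λ g → Joins g l l') × (localColour r c l' ≢ localColour r c l)

-- x, y, z, w have degree three in H; in and out are leaves
isCore : GVert → Bool
isCore gin  = false
isCore gout = false
isCore _    = true

attach : Bool → GEdge
attach false = eux
attach true  = ewv

attachNbr : Bool → GVert
attachNbr false = gx
attachNbr true  = gw

head? : ∀ δ g l → Dec (Head δ g l)
head? δ g l = ((δ ≟ fwd) ×-dec (headEnd g ≟ l)) ⊎-dec ((δ ≟ bwd) ×-dec (tailEnd g ≟ l))

tail? : ∀ δ g l → Dec (Tail δ g l)
tail? δ g l = ((δ ≟ fwd) ×-dec (tailEnd g ≟ l)) ⊎-dec ((δ ≟ bwd) ×-dec (headEnd g ≟ l))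

joins? : ∀ g l l' → Dec (Joins g l l')
joins? g l l' = ((tailEnd g ≟ l) ×-dec (headEnd g ≟ l')) ⊎-dec ((tailEnd g ≟ l') ×-dec (headEnd g ≟ l))

touches? : ∀ g l → Dec (Touches g l)
touches? g l = (tailEnd g ≟ l) ⊎-dec (headEnd g ≟ l)

opposite? : ∀ r c l l' → Dec (OppositeNbr r c l l')
opposite? r c l l' = ∃? (λ g → joins? g l l') ×-dec ¬? (localColour r c l' ≟ localColour r c l)

-- The local facts about the tables, for every role and colour, verified by
-- exhausting all cases.  They are opaque: only their statements are used.
opaque
  gadget-mono : ∀ r c g →
    (gadgetOrient r g ≢ none → localColour r c (tailEnd g) ≡ localColour r c (headEnd g)) ×
    (localColour r c (tailEnd g) ≡ localColour r c (headEnd g) → gadgetOrient r g ≢ none)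
  gadget-mono = from-yes (∀? λ r → ∀? λ c → ∀? λ g →
    (¬? (gadgetOrient r g ≟ none) →-dec (localColour r c (tailEnd g) ≟ localColour r c (headEnd g))) ×-dec
    ((localColour r c (tailEnd g) ≟ localColour r c (headEnd g)) →-dec ¬? (gadgetOrient r g ≟ none)))

  head-unique : ∀ r gv → AtMostOne (λ g → Head (gadgetOrient r g) g (inner gv))
  head-unique = from-yes (∀? λ r → ∀? λ gv → atMostOne? λ g → head? (gadgetOrient r g) g (inner gv))

  tail-unique : ∀ r gv → AtMostOne (λ g → Tail (gadgetOrient r g) g (inner gv))
  tail-unique = from-yes (∀? λ r → ∀? λ gv → atMostOne? λ g → tail? (gadgetOrient r g) g (inner gv))

  opposite-unique : ∀ r c gv → AtMostOne (OppositeNbr r c (inner gv))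
  opposite-unique = from-yes (∀? λ r → ∀? λ c → ∀? λ gv → atMostOne? λ l → opposite? r c (inner gv) l)

  core-balanced : ∀ r c gv → T (isCore gv) →
    (∃ λ g → Head (gadgetOrient r g) g (inner gv)) ×
    (∃ λ g → Tail (gadgetOrient r g) g (inner gv)) ×
    (∃ λ l → OppositeNbr r c (inner gv) l)
  core-balanced = from-yes (∀? λ r → ∀? λ c → ∀? λ gv → T? (isCore gv) →-dec
    (∃? (λ g → head? (gadgetOrient r g) g (inner gv)) ×-dec
     ∃? (λ g → tail? (gadgetOrient r g) g (inner gv)) ×-dec
     ∃? (λ l → opposite? r c (inner gv) l)))

  leaf-degree : ∀ gv → T (not (isCore gv)) → AtMostOne (λ g → Touches g (inner gv))
  leaf-degree = from-yes (∀? λ gv → T? (not (isCore gv)) →-dec atMostOne? (λ g → touches? g (inner gv)))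

  outvertex-source : ∀ r g → ¬ Head (gadgetOrient r g) g (inner gout)
  outvertex-source = from-yes (∀? λ r → ∀? λ g → ¬? (head? (gadgetOrient r g) g (inner gout)))

  head-at-end : ∀ r b g → Head (gadgetOrient r g) g (end b) → (g ≡ attach b) × (r ≡ enters b)
  head-at-end = from-yes (∀? λ r → ∀? λ b → ∀? λ g → head? (gadgetOrient r g) g (end b) →-dec
    ((g ≟ attach b) ×-dec (r ≟ enters b)))

  tail-at-end : ∀ r b g → Tail (gadgetOrient r g) g (end b) → (g ≡ attach b) × (r ≡ enters (not b))
  tail-at-end = from-yes (∀? λ r → ∀? λ b → ∀? λ g → tail? (gadgetOrient r g) g (end b) →-dec
    ((g ≟ attach b) ×-dec (r ≟ enters (not b))))

  opposite-at-end : ∀ r c b l → OppositeNbr r c (end b) l → (r ≡ matching) × (l ≡ inner (attachNbr b))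
  opposite-at-end = from-yes (∀? λ r → ∀? λ c → ∀? λ b → ∀? λ l → opposite? r c (end b) l →-dec
    ((r ≟ matching) ×-dec (l ≟ inner (attachNbr b))))

  head-at-end⁻ : ∀ b → Head (gadgetOrient (enters b) (attach b)) (attach b) (end b)
  head-at-end⁻ = from-yes (∀? λ b → head? (gadgetOrient (enters b) (attach b)) (attach b) (end b))

  tail-at-end⁻ : ∀ b → Tail (gadgetOrient (enters (not b)) (attach b)) (attach b) (end b)
  tail-at-end⁻ = from-yes (∀? λ b → tail? (gadgetOrient (enters (not b)) (attach b)) (attach b) (end b))

  opposite-at-end⁻ : ∀ c b → OppositeNbr matching c (end b) (inner (attachNbr b))
  opposite-at-end⁻ = from-yes (∀? λ c → ∀? λ b → opposite? matching c (end b) (inner (attachNbr b)))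

module Darts (G : Graph) where

  D : Set
  D = Dart G

  dv : D → Fin (n G)
  dv = dartVertex G

  flip-invol : ∀ d → flip G (flip G d) ≡ d
  flip-invol (e , false) = refl
  flip-invol (e , true)  = refl

  flip-free : ∀ d → flip G d ≢ d
  flip-free (e , false) ()
  flip-free (e , true)  ()

  dartCode : D → Fin (m G + m G)
  dartCode (e , false) = e ↑ˡ m G
  dartCode (e , true)  = m G ↑ʳ e

  dartCode-injective : Injective _≡_ _≡_ dartCode
  dartCode-injective {e , false} {f , false} eq = cong (_, false) (↑ˡ-injective (m G) e f eq)
  dartCode-injective {e , true}  {f , true}  eq = cong (_, true) (↑ʳ-injective (m G) e f eq)
  dartCode-injective {e , false} {f , true}  eq with
    trans (sym (splitAt-↑ˡ (m G) e (m G))) (trans (cong (splitAt (m G)) eq) (splitAt-↑ʳ (m G) (m G) f))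
  ... | ()
  dartCode-injective {e , true}  {f , false} eq with
    trans (sym (splitAt-↑ʳ (m G) (m G) e)) (trans (cong (splitAt (m G)) eq) (splitAt-↑ˡ (m G) f (m G)))
  ... | ()

  dart-at : ∀ {e v} → Incident G e v → Σ Bool λ b → dv (e , b) ≡ v
  dart-at (inj₁ p) = false , p
  dart-at (inj₂ p) = true , p

  dart-incident : ∀ d → Incident G (proj₁ d) (dv d)
  dart-incident (e , false) = inj₁ refl
  dart-incident (e , true)  = inj₂ refl

  dart-adjacent : ∀ d → Adj G (dv d) (dv (flip G d))
  dart-adjacent (e , false) = e , inj₁ (refl , refl)
  dart-adjacent (e , true)  = e , inj₂ (refl , refl)

  adjacent-dart : ∀ {u v} → Adj G u v → Σ D λ d → (dv d ≡ u) × (dv (flip G d) ≡ v)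
  adjacent-dart (e , inj₁ (p , q)) = (e , false) , p , q
  adjacent-dart (e , inj₂ (p , q)) = (e , true) , q , p

module SimpleDarts (G : Graph) (simple : Simple G) where
  open Darts G

  -- without loops, an edge has one dart at each of its ends
  dart-unique : ∀ e {b b'} → dv (e , b) ≡ dv (e , b') → b ≡ b'
  dart-unique e {false} {false} _ = refl
  dart-unique e {true}  {true}  _ = refl
  dart-unique e {false} {true}  p = ⊥-elim (proj₁ simple e p)
  dart-unique e {true}  {false} p = ⊥-elim (proj₁ simple e (sym p))

  -- without parallel edges, an edge is determined by its two ends
  same-edge : ∀ {e f} b b' → dv (e , b) ≡ dv (f , b') →
              dv (flip G (e , b)) ≡ dv (flip G (f , b')) → e ≡ f
  same-edge {e} {f} false false p q = proj₂ simple e f (inj₁ (p , q))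
  same-edge {e} {f} false true  p q = proj₂ simple e f (inj₂ (p , q))
  same-edge {e} {f} true  false p q = proj₂ simple e f (inj₂ (q , p))
  same-edge {e} {f} true  true  p q = proj₂ simple e f (inj₁ (q , p))

  dart-by-ends : ∀ {d d'} → dv d ≡ dv d' → dv (flip G d) ≡ dv (flip G d') → d ≡ d'
  dart-by-ends {e , b} {f , b'} p q with same-edge b b' p q
  ... | refl = cong (e ,_) (dart-unique e p)

-- At a vertex of a simple cubic graph the rotation is a 3-cycle of its three darts.
module CubicRotation (G : Graph) (simple : Simple G) (cubic : Cubic G) (emb : PlanarEmbedding G) where
  open PlanarEmbedding emb using (σ; σ-inj; σ-vertex; σ-cyclic)
  open Darts G
  open SimpleDarts G simple

  record ThreeDarts (v : Fin (n G)) : Set where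
    field
      d₁ d₂ d₃ : D
      at₁ : dv d₁ ≡ v
      at₂ : dv d₂ ≡ v
      at₃ : dv d₃ ≡ v
      d₁≢d₂ : d₁ ≢ d₂
      d₁≢d₃ : d₁ ≢ d₃
      d₂≢d₃ : d₂ ≢ d₃
      cover : ∀ d → dv d ≡ v → OneOf3 d d₁ d₂ d₃

  three-darts : ∀ v → ThreeDarts v
  three-darts v with cubic v
  ... | e₁ , e₂ , e₃ , e₁≢e₂ , e₁≢e₃ , e₂≢e₃ , i₁ , i₂ , i₃ , edges = record
    { d₁ = e₁ , proj₁ (dart-at i₁) ; d₂ = e₂ , proj₁ (dart-at i₂) ; d₃ = e₃ , proj₁ (dart-at i₃)
    ; at₁ = proj₂ (dart-at i₁) ; at₂ = proj₂ (dart-at i₂) ; at₃ = proj₂ (dart-at i₃)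
    ; d₁≢d₂ = λ eq → e₁≢e₂ (cong proj₁ eq)
    ; d₁≢d₃ = λ eq → e₁≢e₃ (cong proj₁ eq)
    ; d₂≢d₃ = λ eq → e₂≢e₃ (cong proj₁ eq)
    ; cover = cover
    }
    where
    same-dart : ∀ {e b b'} → dv (e , b) ≡ v → dv (e , b') ≡ v → (e , b) ≡ (e , b')
    same-dart {e} p q = cong (e ,_) (dart-unique e (trans p (sym q)))
    cover : ∀ d → dv d ≡ v →
            OneOf3 d (e₁ , proj₁ (dart-at i₁)) (e₂ , proj₁ (dart-at i₂)) (e₃ , proj₁ (dart-at i₃))
    cover (e , b) at with edges e (subst (Incident G e) at (dart-incident (e , b)))
    ... | inj₁ refl        = inj₁ (same-dart at (proj₂ (dart-at i₁)))
    ... | inj₂ (inj₁ refl) = inj₂ (inj₁ (same-dart at (proj₂ (dart-at i₂))))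
    ... | inj₂ (inj₂ refl) = inj₂ (inj₂ (same-dart at (proj₂ (dart-at i₃))))

  σ²-vertex : ∀ d → dv (σ (σ d)) ≡ dv d
  σ²-vertex d = trans (σ-vertex (σ d)) (σ-vertex d)

  -- if σ² fixed d, the orbit of d, which contains all three darts at its
  -- vertex, would be {d, σ d}
  σ²-moves : ∀ d → σ (σ d) ≢ d
  σ²-moves d σ²d≡d =
    distinct-in-pair d₁≢d₂ d₁≢d₃ d₂≢d₃ (in-orbit d₁ at₁) (in-orbit d₂ at₂) (in-orbit d₃ at₃)
    where
    open ThreeDarts (three-darts (dv d))
    iterates : ∀ k → (iter k σ d ≡ d) ⊎ (iter k σ d ≡ σ d)
    iterates zero = inj₁ refl
    iterates (suc k) with iterates k
    ... | inj₁ p = inj₂ (cong σ p)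
    ... | inj₂ p = inj₁ (trans (cong σ p) σ²d≡d)
    in-orbit : ∀ x → dv x ≡ dv d → (x ≡ d) ⊎ (x ≡ σ d)
    in-orbit x at with σ-cyclic d x (sym at)
    ... | k , reach with iterates k
    ...   | inj₁ p = inj₁ (trans (sym reach) p)
    ...   | inj₂ p = inj₂ (trans (sym reach) p)

  σ-moves : ∀ d → σ d ≢ d
  σ-moves d σd≡d = σ²-moves d (trans (cong σ σd≡d) σd≡d)

  rotation-cover : ∀ d x → dv x ≡ dv d → OneOf3 x d (σ d) (σ (σ d))
  rotation-cover d x at = distinct-in-triple (λ eq → σ-moves d (sym eq)) (λ eq → σ²-moves d (sym eq))
      (λ eq → σ-moves d (σ-inj (sym eq))) (cover d refl) (cover (σ d) (σ-vertex d))
      (cover (σ (σ d)) (σ²-vertex d)) x (cover x at)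
    where open ThreeDarts (three-darts (dv d))

  σ³ : ∀ d → σ (σ (σ d)) ≡ d
  σ³ d with rotation-cover d (σ (σ (σ d))) (trans (σ-vertex (σ (σ d))) (σ²-vertex d))
  ... | inj₁ p        = p
  ... | inj₂ (inj₁ p) = ⊥-elim (σ²-moves d (σ-inj p))
  ... | inj₂ (inj₂ p) = ⊥-elim (σ-moves d (σ-inj (σ-inj p)))

module MatchingDarts (G : Graph) (simple : Simple G) (col : Fin (n G) → Bool) (pm : TwoColouredPM G col) where
  open Darts G
  open SimpleDarts G simple

  inMatching : Fin (m G) → Bool
  inMatching e = does (col (src G e) ≟ col (tgt G e))

  matchingDart : D → Bool
  matchingDart d = inMatching (proj₁ d)

  matching-colour : ∀ d → matchingDart d ≡ true → col (dv (flip G d)) ≡ col (dv d)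
  matching-colour (e , false) p = sym (does-true (col (src G e) ≟ col (tgt G e)) p)
  matching-colour (e , true)  p = does-true (col (src G e) ≟ col (tgt G e)) p

  colour-matching : ∀ d → col (dv (flip G d)) ≡ col (dv d) → matchingDart d ≡ true
  colour-matching (e , false) eq = dec-true (col (src G e) ≟ col (tgt G e)) (sym eq)
  colour-matching (e , true)  eq = dec-true (col (src G e) ≟ col (tgt G e)) eq

  matching-exists : ∀ v → Σ D λ d → (dv d ≡ v) × (matchingDart d ≡ true)
  matching-exists v with proj₁ (pm v)
  ... | u , adj , same with adjacent-dart adj
  ...   | d , refl , refl = d , refl , colour-matching d same

  -- … and only one: two matching darts at a vertex lead to the same neighbour
  matching-unique : ∀ {d d'} → dv d ≡ dv d' →
                    matchingDart d ≡ true → matchingDart d' ≡ true → d ≡ d'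
  matching-unique {d} {d'} at p p' = dart-by-ends at (proj₂ (pm (dv d)) _ _
      (dart-adjacent d , matching-colour d p)
      (subst (λ w → Adj G w (dv (flip G d'))) (sym at) (dart-adjacent d') ,
       trans (matching-colour d' p') (cong col (sym at))))

module Construction (G : Graph) (simple : Simple G) (cubic : Cubic G) (emb : PlanarEmbedding G)
                    (col : Fin (n G) → Bool) (pm : TwoColouredPM G col) where
  open PlanarEmbedding emb using (σ; σ-vertex)
  open Darts G
  open CubicRotation G simple cubic emb
  open MatchingDarts G simple col pm

  σ-of-matching : ∀ {d} → matchingDart d ≡ true → matchingDart (σ d) ≡ false
  σ-of-matching {d} md = ¬-not (λ p → σ-moves d (sym (matching-unique (sym (σ-vertex d)) md p)))

  σ²-of-matching : ∀ {d} → matchingDart d ≡ true → matchingDart (σ (σ d)) ≡ false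
  σ²-of-matching {d} md = ¬-not (λ p → σ²-moves d (sym (matching-unique (sym (σ²-vertex d)) md p)))

  -- At a dart d outside the matching: the other dart outside the matching at its vertex.
  otherDart : D → D
  otherDart d = if matchingDart (σ d) then σ (σ d) else σ d

  other-view : ∀ d → matchingDart d ≡ false →
    (matchingDart (σ d) ≡ true × matchingDart (σ (σ d)) ≡ false × otherDart d ≡ σ (σ d)) ⊎
    (matchingDart (σ d) ≡ false × matchingDart (σ (σ d)) ≡ true × otherDart d ≡ σ d)
  other-view d nm with matching-exists (dv d)
  ... | m , at , mm with rotation-cover d m at
  ...   | inj₁ refl        = ⊥-elim (true≢false (trans (sym mm) nm))
  ...   | inj₂ (inj₁ refl) = inj₁ (mm , σ-of-matching mm , if-true mm)
  ...   | inj₂ (inj₂ refl) = inj₂ (σd-nm , mm , if-false σd-nm)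
    where
    σd-nm : matchingDart (σ d) ≡ false
    σd-nm = subst (λ x → matchingDart x ≡ false) (σ³ (σ d)) (σ²-of-matching mm)

  other-vertex : ∀ d → matchingDart d ≡ false → dv (otherDart d) ≡ dv d
  other-vertex d nm with other-view d nm
  ... | inj₁ (_ , _ , eq) = trans (cong dv eq) (σ²-vertex d)
  ... | inj₂ (_ , _ , eq) = trans (cong dv eq) (σ-vertex d)

  other-nonmatching : ∀ d → matchingDart d ≡ false → matchingDart (otherDart d) ≡ false
  other-nonmatching d nm with other-view d nm
  ... | inj₁ (_ , nm' , eq) = trans (cong matchingDart eq) nm'
  ... | inj₂ (nm' , _ , eq) = trans (cong matchingDart eq) nm'

  other-moves : ∀ d → matchingDart d ≡ false → otherDart d ≢ d
  other-moves d nm with other-view d nm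
  ... | inj₁ (_ , _ , eq) = λ p → σ²-moves d (trans (sym eq) p)
  ... | inj₂ (_ , _ , eq) = λ p → σ-moves d (trans (sym eq) p)

  other-invol : ∀ d → matchingDart d ≡ false → otherDart (otherDart d) ≡ d
  other-invol d nm with other-view d nm
  ... | inj₁ (_ , _ , eq) = begin
    otherDart (otherDart d)  ≡⟨ cong otherDart eq ⟩
    otherDart (σ (σ d))      ≡⟨ if-false (trans (cong matchingDart (σ³ d)) nm) ⟩
    σ (σ (σ d))              ≡⟨ σ³ d ⟩
    d                        ∎
    where open ≡-Reasoning
  ... | inj₂ (_ , mm , eq) = begin
    otherDart (otherDart d)  ≡⟨ cong otherDart eq ⟩
    otherDart (σ d)          ≡⟨ if-true mm ⟩
    σ (σ (σ d))              ≡⟨ σ³ d ⟩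
    d                        ∎
    where open ≡-Reasoning

  other-cover : ∀ d x → matchingDart d ≡ false → matchingDart x ≡ false → dv x ≡ dv d →
                (x ≡ d) ⊎ (x ≡ otherDart d)
  other-cover d x nm nmx at with rotation-cover d x at | other-view d nm
  ... | inj₁ p           | _                  = inj₁ p
  ... | inj₂ (inj₁ p)    | inj₂ (_ , _ , eq)  = inj₂ (trans p (sym eq))
  ... | inj₂ (inj₂ p)    | inj₁ (_ , _ , eq)  = inj₂ (trans p (sym eq))
  ... | inj₂ (inj₁ refl) | inj₁ (mm , _ , _)  = ⊥-elim (true≢false (trans (sym mm) nmx))
  ... | inj₂ (inj₂ refl) | inj₂ (_ , mm , _)  = ⊥-elim (true≢false (trans (sym mm) nmx))

  -- The alternating cycles of flip and
  -- partner run along the cycles of the 2-factor G - M.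
  partner : D → D
  partner d = if matchingDart d then flip G d else otherDart d

  partner-invol : ∀ d → partner (partner d) ≡ d
  partner-invol d with bool-cases (matchingDart d)
  ... | inj₁ md = trans (cong partner (if-true md)) (trans (if-true md) (flip-invol d))
  ... | inj₂ nm = trans (cong partner (if-false nm)) (trans (if-false (other-nonmatching d nm)) (other-invol d nm))

  partner-free : ∀ d → partner d ≢ d
  partner-free d with bool-cases (matchingDart d)
  ... | inj₁ md = λ p → flip-free d (trans (sym (if-true md)) p)
  ... | inj₂ nm = λ p → other-moves d nm (trans (sym (if-false nm)) p)

  open AlternatingCycles dartCode dartCode-injective (flip G) partner flip-invol partner-invol flip-free partner-free
    using (side; side-r; side-t)

  -- d is a non-matching dart on side s (s = true: its edge is oriented away from the vertex of d)
  Oriented : D → Bool → Set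
  Oriented d s = (matchingDart d ≡ false) × (side d ≡ s)

  oriented-exists : ∀ v s → Σ D λ d → (dv d ≡ v) × Oriented d s
  oriented-exists v s with matching-exists v
  ... | m , at , mm with side (σ m) ≟ s
  ...   | yes eq  = σ m , trans (σ-vertex m) at , nm , eq
    where nm = σ-of-matching mm
  ...   | no s≢ = otherDart (σ m) , trans (other-vertex (σ m) nm) (trans (σ-vertex m) at) ,
                  other-nonmatching (σ m) nm , side-other
    where
    nm = σ-of-matching mm
    side-other : side (otherDart (σ m)) ≡ s
    side-other = begin
      side (otherDart (σ m))  ≡⟨ cong side (sym (if-false nm)) ⟩
      side (partner (σ m))    ≡⟨ side-t (σ m) ⟩
      not (side (σ m))        ≡⟨ cong not (¬-not s≢) ⟩
      not (not s)             ≡⟨ not-involutive s ⟩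
      s                       ∎
      where open ≡-Reasoning

  oriented-unique : ∀ {d d' s} → dv d ≡ dv d' → Oriented d s → Oriented d' s → d ≡ d'
  oriented-unique {d} {d'} {s} at (nm , sd) (nm' , sd') with other-cover d d' nm nm' (sym at)
  ... | inj₁ p = sym p
  ... | inj₂ p = ⊥-elim (not-¬ refl (begin
    s                        ≡⟨ sym sd' ⟩
    side d'                  ≡⟨ cong side (trans p (sym (if-false nm))) ⟩
    side (partner d)         ≡⟨ side-t d ⟩
    not (side d)             ≡⟨ cong not sd ⟩
    not s                    ∎))
    where open ≡-Reasoning

  -- the role of an edge: in the matching, or oriented towards its end b with side (e , b) = false
  role : Fin (m G) → Role
  role e = if inMatching e then matching else enters (side (e , false))

  role-cases : ∀ e → (inMatching e ≡ true × role e ≡ matching) ⊎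
                     (inMatching e ≡ false × role e ≡ enters (side (e , false)))
  role-cases e with bool-cases (inMatching e)
  ... | inj₁ p = inj₁ (p , if-true p)
  ... | inj₂ p = inj₂ (p , if-false p)

  entered-end : ∀ e b → side (e , b) ≡ false → side (e , false) ≡ b
  entered-end e false p = p
  entered-end e true  p = not-injective (trans (sym (side-r (e , false))) p)

  entered-end⁻ : ∀ e b → side (e , false) ≡ b → side (e , b) ≡ false
  entered-end⁻ e false p = p
  entered-end⁻ e true  p = trans (side-r (e , false)) (cong not p)

  role-enters : ∀ e b → role e ≡ enters b → Oriented (e , b) false
  role-enters e b eq with role-cases e
  ... | inj₁ (_ , r≡) with trans (sym r≡) eq
  ...   | ()
  role-enters e b eq | inj₂ (nm , r≡) with trans (sym r≡) eq
  ...   | refl = nm , entered-end⁻ e b refl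

  role-enters⁻ : ∀ e b → Oriented (e , b) false → role e ≡ enters b
  role-enters⁻ e b (nm , sd) = trans (if-false nm) (cong enters (entered-end e b sd))

  role-matching : ∀ e → role e ≡ matching → inMatching e ≡ true
  role-matching e eq with role-cases e
  ... | inj₁ (mm , _) = mm
  ... | inj₂ (_ , r≡) with trans (sym r≡) eq
  ...   | ()

  oriented-flip : ∀ d → Oriented (flip G d) false → Oriented d true
  oriented-flip d (nm , sd) = nm , not-injective (trans (sym (side-r d)) sd)

  oriented-flip⁻ : ∀ d → Oriented d true → Oriented (flip G d) false
  oriented-flip⁻ d (nm , sd) = nm , trans (side-r d) (cong not sd)

  srcColour : Fin (m G) → Bool
  srcColour e = col (src G e)

  tgt-colour : ∀ e → col (tgt G e) ≡ endColour (role e) (srcColour e) true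
  tgt-colour e with role-cases e
  ... | inj₁ (mm , r≡) = trans (matching-colour (e , false) mm)
                               (cong (λ r → endColour r (srcColour e) true) (sym r≡))
  ... | inj₂ (nm , r≡) = trans (¬-not (λ eq → does-false (srcColour e ≟ col (tgt G e)) nm (sym eq)))
                               (cong (λ r → endColour r (srcColour e) true) (sym r≡))

  hColour : HVert G → Bool
  hColour (inj₁ v)       = col v
  hColour (inj₂ (e , g)) = gadgetColour (role e) (srcColour e) g

  hOrient : HEdge G → Dir
  hOrient (e , g) = gadgetOrient (role e) g

  toH : Fin (m G) → LocalVertex → HVert G
  toH e (end b)   = inj₁ (dv (e , b))
  toH e (inner g) = inj₂ (e , g)

  hColour-toH : ∀ e l → hColour (toH e l) ≡ localColour (role e) (srcColour e) l
  hColour-toH e (end false) = refl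
  hColour-toH e (end true)  = tgt-colour e
  hColour-toH e (inner g)   = refl

  ends-local : ∀ e g → hEnds G (e , g) ≡ (toH e (tailEnd g) , toH e (headEnd g))
  ends-local e eux   = refl
  ends-local e exy   = refl
  ends-local e exz   = refl
  ends-local e eyw   = refl
  ends-local e ezw   = refl
  ends-local e ewv   = refl
  ends-local e eyin  = refl
  ends-local e ezout = refl

  hEnd1-local : ∀ e g → hEnd1 G (e , g) ≡ toH e (tailEnd g)
  hEnd1-local e g = cong proj₁ (ends-local e g)

  hEnd2-local : ∀ e g → hEnd2 G (e , g) ≡ toH e (headEnd g)
  hEnd2-local e g = cong proj₂ (ends-local e g)

  toH-inner : ∀ {e e' l gv} → toH e l ≡ inj₂ (e' , gv) → (e ≡ e') × (l ≡ inner gv)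
  toH-inner {l = inner g} refl = refl , refl

  toH-vertex : ∀ {e l v} → toH e l ≡ inj₁ v → Σ Bool λ b → (l ≡ end b) × (dv (e , b) ≡ v)
  toH-vertex {l = end b} refl = b , refl , refl

  into-local : ∀ e g {a} → Into G hOrient (e , g) a →
               Σ LocalVertex λ l → (toH e l ≡ a) × Head (hOrient (e , g)) g l
  into-local e g (inj₁ (o , p)) = headEnd g , trans (sym (hEnd2-local e g)) p , inj₁ (o , refl)
  into-local e g (inj₂ (o , p)) = tailEnd g , trans (sym (hEnd1-local e g)) p , inj₂ (o , refl)

  into-global : ∀ e g {l} → Head (hOrient (e , g)) g l → Into G hOrient (e , g) (toH e l)
  into-global e g (inj₁ (o , refl)) = inj₁ (o , hEnd2-local e g)
  into-global e g (inj₂ (o , refl)) = inj₂ (o , hEnd1-local e g)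

  out-local : ∀ e g {a} → OutOf G hOrient (e , g) a →
              Σ LocalVertex λ l → (toH e l ≡ a) × Tail (hOrient (e , g)) g l
  out-local e g (inj₁ (o , p)) = tailEnd g , trans (sym (hEnd1-local e g)) p , inj₁ (o , refl)
  out-local e g (inj₂ (o , p)) = headEnd g , trans (sym (hEnd2-local e g)) p , inj₂ (o , refl)

  out-global : ∀ e g {l} → Tail (hOrient (e , g)) g l → OutOf G hOrient (e , g) (toH e l)
  out-global e g (inj₁ (o , refl)) = inj₁ (o , hEnd1-local e g)
  out-global e g (inj₂ (o , refl)) = inj₂ (o , hEnd2-local e g)

  touches-local : ∀ e g {a} → HIncident G (e , g) a → Σ LocalVertex λ l → (toH e l ≡ a) × Touches g l
  touches-local e g (inj₁ p) = tailEnd g , trans (sym (hEnd1-local e g)) p , inj₁ refl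
  touches-local e g (inj₂ p) = headEnd g , trans (sym (hEnd2-local e g)) p , inj₂ refl

  local-colours : ∀ e {l l' a x} → toH e l ≡ a → toH e l' ≡ x → hColour x ≢ hColour a →
                  localColour (role e) (srcColour e) l' ≢ localColour (role e) (srcColour e) l
  local-colours e {l} {l'} refl refl ne eq = ne (trans (hColour-toH e l') (trans eq (sym (hColour-toH e l))))

  opposite-local : ∀ {a x} → HAdj G a x → hColour x ≢ hColour a →
    Σ (Fin (m G)) λ e → Σ LocalVertex λ l → Σ LocalVertex λ l' →
      (toH e l ≡ a) × (toH e l' ≡ x) × OppositeNbr (role e) (srcColour e) l l'
  opposite-local ((e , g) , inj₁ (p , q)) ne =
    e , tailEnd g , headEnd g , p' , q' , (g , inj₁ (refl , refl)) , local-colours e p' q' ne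
    where
    p' = trans (sym (hEnd1-local e g)) p
    q' = trans (sym (hEnd2-local e g)) q
  opposite-local ((e , g) , inj₂ (p , q)) ne =
    e , headEnd g , tailEnd g , q' , p' , (g , inj₂ (refl , refl)) , local-colours e q' p' ne
    where
    p' = trans (sym (hEnd1-local e g)) p
    q' = trans (sym (hEnd2-local e g)) q

  opposite-global : ∀ e {l l'} → OppositeNbr (role e) (srcColour e) l l' →
                    HAdj G (toH e l) (toH e l') × (hColour (toH e l') ≢ hColour (toH e l))
  opposite-global e {l} {l'} ((g , joins) , ne) = adjacent joins ,
    λ eq → ne (trans (sym (hColour-toH e l')) (trans eq (hColour-toH e l)))
    where
    adjacent : Joins g l l' → HAdj G (toH e l) (toH e l')
    adjacent (inj₁ (refl , refl)) = (e , g) , inj₁ (hEnd1-local e g , hEnd2-local e g)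
    adjacent (inj₂ (refl , refl)) = (e , g) , inj₂ (hEnd1-local e g , hEnd2-local e g)

  -- At a vertex v of G the edges of H are the attachment edges of the darts at v.
  attachEdge : D → HEdge G
  attachEdge (e , b) = e , attach b

  attachNeighbour : D → HVert G
  attachNeighbour (e , b) = inj₂ (e , attachNbr b)

  vertex-in : ∀ {h v} → Into G hOrient h (inj₁ v) →
              Σ D λ d → (dv d ≡ v) × (h ≡ attachEdge d) × Oriented d false
  vertex-in {e , g} i with into-local e g i
  ... | l , p , hd with toH-vertex p
  ...   | b , refl , at with head-at-end (role e) b g hd
  ...     | refl , r≡ = (e , b) , at , refl , role-enters e b r≡

  vertex-in⁻ : ∀ {v} d → dv d ≡ v → Oriented d false → Into G hOrient (attachEdge d) (inj₁ v)
  vertex-in⁻ (e , b) refl o = into-global e (attach b)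
    (subst (λ r → Head (gadgetOrient r (attach b)) (attach b) (end b)) (sym (role-enters⁻ e b o))
           (head-at-end⁻ b))

  vertex-out : ∀ {h v} → OutOf G hOrient h (inj₁ v) →
               Σ D λ d → (dv d ≡ v) × (h ≡ attachEdge d) × Oriented d true
  vertex-out {e , g} o with out-local e g o
  ... | l , p , tl with toH-vertex p
  ...   | b , refl , at with tail-at-end (role e) b g tl
  ...     | refl , r≡ = (e , b) , at , refl , oriented-flip (e , b) (role-enters e (not b) r≡)

  vertex-out⁻ : ∀ {v} d → dv d ≡ v → Oriented d true → OutOf G hOrient (attachEdge d) (inj₁ v)
  vertex-out⁻ (e , b) refl o = out-global e (attach b)
    (subst (λ r → Tail (gadgetOrient r (attach b)) (attach b) (end b))
           (sym (role-enters⁻ e (not b) (oriented-flip⁻ (e , b) o))) (tail-at-end⁻ b))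

  vertex-opp : ∀ {v x} → HAdj G (inj₁ v) x → hColour x ≢ col v →
               Σ D λ d → (dv d ≡ v) × (x ≡ attachNeighbour d) × (matchingDart d ≡ true)
  vertex-opp adj ne with opposite-local adj ne
  ... | e , l , l' , p , q , op with toH-vertex p
  ...   | b , refl , at with opposite-at-end (role e) (srcColour e) b l' op
  ...     | r≡ , refl = (e , b) , at , sym q , role-matching e r≡

  vertex-opp⁻ : ∀ {v} d → dv d ≡ v → matchingDart d ≡ true →
                HAdj G (inj₁ v) (attachNeighbour d) × (hColour (attachNeighbour d) ≢ col v)
  vertex-opp⁻ (e , b) refl md = opposite-global e
    (subst (λ r → OppositeNbr r (srcColour e) (end b) (inner (attachNbr b))) (sym (if-true md))
           (opposite-at-end⁻ (srcColour e) b))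

  -- At an inner vertex of the gadget of e everything happens inside that gadget.
  gadget-in : ∀ {h e gv} → Into G hOrient h (inj₂ (e , gv)) →
              Σ GEdge λ g → (h ≡ (e , g)) × Head (gadgetOrient (role e) g) g (inner gv)
  gadget-in {e , g} i with into-local e g i
  ... | l , p , hd with toH-inner p
  ...   | refl , refl = g , refl , hd

  gadget-out : ∀ {h e gv} → OutOf G hOrient h (inj₂ (e , gv)) →
               Σ GEdge λ g → (h ≡ (e , g)) × Tail (gadgetOrient (role e) g) g (inner gv)
  gadget-out {e , g} o with out-local e g o
  ... | l , p , tl with toH-inner p
  ...   | refl , refl = g , refl , tl

  gadget-touch : ∀ {h e gv} → HIncident G h (inj₂ (e , gv)) →
                 Σ GEdge λ g → (h ≡ (e , g)) × Touches g (inner gv)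
  gadget-touch {e , g} t with touches-local e g t
  ... | l , p , tg with toH-inner p
  ...   | refl , refl = g , refl , tg

  gadget-opp : ∀ {e gv x} → HAdj G (inj₂ (e , gv)) x → hColour x ≢ hColour (inj₂ (e , gv)) →
               Σ LocalVertex λ l' → (x ≡ toH e l') × OppositeNbr (role e) (srcColour e) (inner gv) l'
  gadget-opp adj ne with opposite-local adj ne
  ... | e , l , l' , p , q , op with toH-inner p
  ...   | refl , refl = l' , sym q , op

  in-unique : ∀ a → AtMostOne (λ h → Into G hOrient h a)
  in-unique (inj₁ v) h h' i i' with vertex-in i | vertex-in i'
  ... | d , at , refl , o | d' , at' , refl , o' = cong attachEdge (oriented-unique (trans at (sym at')) o o')
  in-unique (inj₂ (e , gv)) h h' i i' with gadget-in i | gadget-in i'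
  ... | g , refl , hd | g' , refl , hd' = cong (e ,_) (head-unique (role e) gv g g' hd hd')

  out-unique : ∀ a → AtMostOne (λ h → OutOf G hOrient h a)
  out-unique (inj₁ v) h h' o o' with vertex-out o | vertex-out o'
  ... | d , at , refl , s | d' , at' , refl , s' = cong attachEdge (oriented-unique (trans at (sym at')) s s')
  out-unique (inj₂ (e , gv)) h h' o o' with gadget-out o | gadget-out o'
  ... | g , refl , tl | g' , refl , tl' = cong (e ,_) (tail-unique (role e) gv g g' tl tl')

  opp-unique : ∀ a → AtMostOne (λ x → HAdj G a x × (hColour x ≢ hColour a))
  opp-unique (inj₁ v) x x' (adj , ne) (adj' , ne') with vertex-opp adj ne | vertex-opp adj' ne'
  ... | d , at , refl , md | d' , at' , refl , md' =
    cong attachNeighbour (matching-unique (trans at (sym at')) md md')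
  opp-unique (inj₂ (e , gv)) x x' (adj , ne) (adj' , ne') with gadget-opp adj ne | gadget-opp adj' ne'
  ... | l , refl , op | l' , refl , op' = cong (toH e) (opposite-unique (role e) (srcColour e) gv l l' op op')

  oriented-iff-mono : ∀ h → (hOrient h ≢ none → hColour (hEnd1 G h) ≡ hColour (hEnd2 G h)) ×
                            (hColour (hEnd1 G h) ≡ hColour (hEnd2 G h) → hOrient h ≢ none)
  oriented-iff-mono (e , g) = (λ o → trans c₁ (trans (proj₁ local o) (sym c₂))) ,
                              (λ eq → proj₂ local (trans (sym c₁) (trans eq c₂)))
    where
    local : (gadgetOrient (role e) g ≢ none →
               localColour (role e) (srcColour e) (tailEnd g) ≡ localColour (role e) (srcColour e) (headEnd g)) ×
            (localColour (role e) (srcColour e) (tailEnd g) ≡ localColour (role e) (srcColour e) (headEnd g) →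
               gadgetOrient (role e) g ≢ none)
    local = gadget-mono (role e) (srcColour e) g
    c₁ : hColour (hEnd1 G (e , g)) ≡ localColour (role e) (srcColour e) (tailEnd g)
    c₁ = trans (cong hColour (hEnd1-local e g)) (hColour-toH e (tailEnd g))
    c₂ : hColour (hEnd2 G (e , g)) ≡ localColour (role e) (srcColour e) (headEnd g)
    c₂ = trans (cong hColour (hEnd2-local e g)) (hColour-toH e (headEnd g))

  outvertices-sources : ∀ a → IsOutvertex G a → ∀ h → ¬ Into G hOrient h a
  outvertices-sources _ (e , refl) h i with gadget-in i
  ... | g , refl , hd = outvertex-source (role e) g hd

  -- the coloured orientation of H (outdegree is even at most one)
  colouredOrientation : ColouredOrientation G
  colouredOrientation = record
    { colour          = hColour
    ; orient          = hOrient
    ; atMostOneOpp    = opp-unique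
    ; orientedIffMono = oriented-iff-mono
    ; outDeg≤2        = λ a _ h₁ h₂ _ o₁ o₂ _ → inj₁ (out-unique a h₁ h₂ o₁ o₂)
    ; inDeg≤1         = λ a _ → in-unique a
    ; outIn0          = outvertices-sources
    }

  GoodAt : HVert G → Set
  GoodAt a = ExactlyOne (λ x → HAdj G a x × (hColour x ≢ hColour a)) ×
             ExactlyOne (λ h → Into G hOrient h a) ×
             ExactlyOne (λ h → OutOf G hOrient h a)

  -- at v: the matching dart gives the opposite neighbour, the two non-matching
  -- darts the incoming and the outgoing edge
  vertex-good : ∀ v → GoodAt (inj₁ v)
  vertex-good v = (opposite , opp-unique (inj₁ v)) , (incoming , in-unique (inj₁ v)) ,
                  (outgoing , out-unique (inj₁ v))
    where
    opposite : Σ (HVert G) λ x → HAdj G (inj₁ v) x × (hColour x ≢ col v)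
    opposite with matching-exists v
    ... | d , at , md = attachNeighbour d , vertex-opp⁻ d at md
    incoming : Σ (HEdge G) λ h → Into G hOrient h (inj₁ v)
    incoming with oriented-exists v false
    ... | d , at , o = attachEdge d , vertex-in⁻ d at o
    outgoing : Σ (HEdge G) λ h → OutOf G hOrient h (inj₁ v)
    outgoing with oriented-exists v true
    ... | d , at , o = attachEdge d , vertex-out⁻ d at o

  core-good : ∀ e gv → T (isCore gv) → GoodAt (inj₂ (e , gv))
  core-good e gv core with core-balanced (role e) (srcColour e) gv core
  ... | (g , hd) , (g' , tl) , (l , op) =
    ((toH e l , opposite-global e op) , opp-unique _) ,
    (((e , g) , into-global e g hd) , in-unique _) ,
    (((e , g') , out-global e g' tl) , out-unique _)

  -- in and out are leaves of H, so not of degree three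
  leaf-not-degree3 : ∀ e gv → T (not (isCore gv)) → ¬ HDegree3 G (inj₂ (e , gv))
  leaf-not-degree3 e gv leaf (h₁ , h₂ , _ , h₁≢h₂ , _ , _ , t₁ , t₂ , _ , _)
    with gadget-touch {h₁} t₁ | gadget-touch {h₂} t₂
  ... | g , refl , tg | g' , refl , tg' = h₁≢h₂ (cong (e ,_) (leaf-degree gv leaf g g' tg tg'))

  good : Good G colouredOrientation
  good (inj₁ v)          _    = vertex-good v
  good (inj₂ (e , gx))   _    = core-good e gx _
  good (inj₂ (e , gy))   _    = core-good e gy _
  good (inj₂ (e , gz))   _    = core-good e gz _
  good (inj₂ (e , gw))   _    = core-good e gw _
  good (inj₂ (e , gin))  deg3 = ⊥-elim (leaf-not-degree3 e gin _ deg3)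
  good (inj₂ (e , gout)) deg3 = ⊥-elim (leaf-not-degree3 e gout _ deg3)

lemma10 : (G : Graph) → Simple G → Cubic G → Planar G →
          HasTwoColouredPM G → HasGoodColouredOrientation G
lemma10 G simple cubic planar (col , pm) = colouredOrientation , good
  where open Construction G simple cubic planar col pm
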